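{- Let $\mathbf F$ be the free semiring generated by an alphabet $\Sigma$, and let $E$ be a set of equations $e_1=1,\ e_2=1,\ \dots$ with all $e_i\in\mathbf F$. For any $p,q\in\mathbf F$, the elements $p$ and $q$ are congruent modulo the semiring congruence on $\mathbf F$ generated by $E$ if and only if there exists $r\in\mathbf F$ which is an expansion of both $p$ and $q$.
   Context: A semiring is an algebra $(S,+,\cdot,0,1)$ where $(S,+,0)$ is a commutative monoid, $(S,\cdot,1)$ is a monoid (not necessarily commutative), $0\cdot x=x\cdot 0=0$, and both distributive laws $a(b+c)=ab+ac$, $(a+b)c=ac+bc$ hold. The free semiring $\mathbf F$ over $\Sigma$ consists of finite multisets (formal sums) of words in the free monoid $\Sigma^*$ (monomials); addition is multiset union and $p\cdot q$ is the formal sum of all products $uv$ with $u$ a summand of $p$ and $v$ a summand of $q$ (counted with multiplicity); $1$ is the empty word and $0$ the empty sum. For a monomial $u\in\Sigma^*$, a single expansion of $u$ is any element of $\mathbf F$ of the form $v\,e_i\,w$ where $v,w\in\Sigma^*$ with $vw=u$ and $e_i$ is one of the left-hand sides of $E$. A single expansion of a general $p\in\mathbf F$ is obtained by replacing one of its summands by a single expansion of that summand. An element $r$ is an expansion of $p$ if $r$ can be obtained from $p$ by a finite (possibly empty) sequence of single expansion steps. -}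

module Defs where

open import Data.List using (List; []; _∷_; _++_; map; concatMap; [_])
open import Data.List.Relation.Binary.Permutation.Propositional using (_↭_)
open import Data.Product using (Σ; ∃; _×_; _,_)
open import Relation.Binary.PropositionalEquality using (_≡_)

Word : Set → Set
Word A = List A

-- Elements of the free semiring F over A: finite formal sums (multisets) of words,
-- represented as lists of words; two representations denote the same element of F
-- iff they are permutations of each other (_↭_).
F : Set → Set
F A = List (Word A)

module _ {A : Set} where

  0F : F A
  0F = []

  1F : F A
  1F = [ [] ]

  infixl 6 _⊕_
  infixl 7 _⊙_

  _⊕_ : F A → F A → F A
  p ⊕ q = p ++ q

  _⊙_ : F A → F A → F A
  p ⊙ q = concatMap (λ u → map (λ v → u ++ v) q) p

  mono : Word A → F A
  mono u = [ u ]

  module _ {I : Set} (e : I → F A) where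

    data Cong : F A → F A → Set where
      c-eq    : ∀ {p q} → p ↭ q → Cong p q
      c-gen   : ∀ i → Cong (e i) 1F
      c-sym   : ∀ {p q} → Cong p q → Cong q p
      c-trans : ∀ {p q r} → Cong p q → Cong q r → Cong p r
      c-+     : ∀ {p p' q q'} → Cong p p' → Cong q q' → Cong (p ⊕ q) (p' ⊕ q')
      c-·     : ∀ {p p' q q'} → Cong p p' → Cong q q' → Cong (p ⊙ q) (p' ⊙ q')

    SingleExpansion : F A → F A → Set
    SingleExpansion p r =
      Σ (F A) λ xs → Σ (F A) λ ys → Σ (Word A) λ v → Σ (Word A) λ w → Σ I λ i →
        (p ↭ xs ⊕ (mono (v ++ w) ⊕ ys)) × (r ↭ xs ⊕ ((mono v ⊙ e i ⊙ mono w) ⊕ ys))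

    data Expansion : F A → F A → Set where
      done : ∀ {p r} → p ↭ r → Expansion p r
      step : ∀ {p q r} → SingleExpansion p q → Expansion q r → Expansion p r

-- Soundness is immediate: a single expansion replaces v w by v · 1 · w and then 1 by e_i.
-- For completeness it suffices that "having a common expansion" is a congruence; it plainly
-- contains the generators and is compatible with + and ·, and it is transitive because
-- expansion is confluent. Expansion need not terminate, so confluence cannot come from local
-- confluence; instead, parallel expansion (every summand expanded at most once) has the
-- diamond property. Its heart is a monomial expanded by e_i at position v and by e_j at
-- position v ++ t: both results lead in one parallel step to the sum of all v x t y w with
-- x ∈ e_i, y ∈ e_j.
module Submission where

open import Defs
open import Level using (Level)
open import Data.List using (List; []; _∷_; _++_; map; concatMap; [_])
open import Data.List.Properties
  using (++-assoc; ++-identityʳ; ∷-injective; map-id; map-cong; map-∘; map-++;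
         concatMap-++; concatMap-cong; concatMap-map; concatMap-pure)
open import Data.List.Relation.Binary.Permutation.Propositional
open import Data.List.Relation.Binary.Permutation.Propositional.Properties
  using (++⁺ˡ; ++⁺; shifts; map⁺)
open import Data.Product using (Σ; ∃; ∃₂; ∃-syntax; _×_; _,_; -,_)
open import Data.Sum using (_⊎_; inj₁; inj₂)
open import Function.Base using (_∘_)
open import Function.Bundles using (_⇔_; mk⇔)
open import Relation.Binary.Core using (Rel)
open import Relation.Binary.Construct.Closure.ReflexiveTransitive
  using (Star; ε; _◅_; _◅◅_; gmap)
open import Relation.Binary.Rewriting using (Confluent)
open import Relation.Binary.PropositionalEquality
  using (_≡_; refl; sym; cong; subst; module ≡-Reasoning)
  renaming (trans to ≡-trans)

private
  variable
    a b c ℓ : Level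
    A : Set a
    B : Set b
    C : Set c

Diamond : Rel A ℓ → Set _
Diamond _⟶_ = ∀ {x y z} → x ⟶ y → x ⟶ z → ∃ λ w → y ⟶ w × z ⟶ w

diamond⇒confluent : {_⟶_ : Rel A ℓ} → Diamond _⟶_ → Confluent _⟶_
diamond⇒confluent {_⟶_ = _⟶_} ◇ = confluent
  where
  strip : ∀ {x y z} → x ⟶ y → Star _⟶_ x z → ∃ λ w → Star _⟶_ y w × z ⟶ w
  strip x⟶y ε = -, ε , x⟶y
  strip x⟶y (x⟶x′ ◅ x′⟶*z) with ◇ x⟶y x⟶x′
  ... | w , y⟶w , x′⟶w with strip x′⟶w x′⟶*z
  ...   | w′ , w⟶*w′ , z⟶w′ = w′ , y⟶w ◅ w⟶*w′ , z⟶w′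

  confluent : Confluent _⟶_
  confluent ε x⟶*z = -, x⟶*z , ε
  confluent (x⟶x′ ◅ x′⟶*y) x⟶*z with strip x⟶x′ x⟶*z
  ... | w , x′⟶*w , z⟶w with confluent x′⟶*y x′⟶*w
  ...   | d , y⟶*d , w⟶*d = d , y⟶*d , z⟶w ◅ w⟶*d

++-split : (v w v′ w′ : List A) → v ++ w ≡ v′ ++ w′ →
  (∃[ t ] v′ ≡ v ++ t × w ≡ t ++ w′) ⊎ (∃[ t ] v ≡ v′ ++ t × w′ ≡ t ++ w)
++-split []      w v′       w′ eq = inj₁ (v′ , refl , eq)
++-split (x ∷ v) w []       w′ eq = inj₂ (x ∷ v , refl , sym eq)
++-split (x ∷ v) w (y ∷ v′) w′ eq with ∷-injective eq
... | refl , eq′ with ++-split v w v′ w′ eq′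
...   | inj₁ (t , refl , w≡t++w′) = inj₁ (t , refl , w≡t++w′)
...   | inj₂ (t , refl , w′≡t++w) = inj₂ (t , refl , w′≡t++w)

++-assoc₄ : (w x y z : List A) → (w ++ x ++ y) ++ z ≡ w ++ x ++ y ++ z
++-assoc₄ w x y z = ≡-trans (++-assoc w (x ++ y) z) (cong (w ++_) (++-assoc x y z))

concatMap-∷-↭ : (g : B → A) (h : B → List A) (ys : List B) →
  concatMap (λ y → g y ∷ h y) ys ↭ map g ys ++ concatMap h ys
concatMap-∷-↭ g h []       = ↭-refl
concatMap-∷-↭ g h (y ∷ ys) =
  prep (g y) (↭-trans (++⁺ˡ (h y) (concatMap-∷-↭ g h ys)) (shifts (h y) (map g ys)))

concatMap-map-comm : (f : A → B → C) (xs : List A) (ys : List B) →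
  concatMap (λ x → map (f x) ys) xs ↭ concatMap (λ y → map (λ x → f x y) xs) ys
concatMap-map-comm f []       ys = ↭-reflexive (sym (concatMap-[] ys))
  where
  concatMap-[] : (ys : List B) → concatMap {B = C} (λ _ → []) ys ≡ []
  concatMap-[] []       = refl
  concatMap-[] (_ ∷ ys) = concatMap-[] ys
concatMap-map-comm f (x ∷ xs) ys =
  ↭-trans (++⁺ˡ (map (f x) ys) (concatMap-map-comm f xs ys))
          (↭-sym (concatMap-∷-↭ (f x) (λ y → map (λ x′ → f x′ y) xs) ys))

module _ {A : Set} where

  sandwich : Word A → Word A → F A → F A
  sandwich v w = map (λ x → v ++ x ++ w)

  mono-⊙-mono : (v w : Word A) (q : F A) → mono v ⊙ q ⊙ mono w ≡ sandwich v w q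
  mono-⊙-mono v w q = begin
    concatMap (λ u → [ u ++ w ]) (map (v ++_) q ++ [])
      ≡⟨ cong (concatMap (λ u → [ u ++ w ])) (++-identityʳ (map (v ++_) q)) ⟩
    concatMap ([_] ∘ (_++ w)) (map (v ++_) q)
      ≡⟨ concatMap-map [_] (_++ w) (map (v ++_) q) ⟨
    concatMap [_] (map (_++ w) (map (v ++_) q))
      ≡⟨ concatMap-pure (map (_++ w) (map (v ++_) q)) ⟩
    map (_++ w) (map (v ++_) q)
      ≡⟨ map-∘ q ⟨
    map ((_++ w) ∘ (v ++_)) q
      ≡⟨ map-cong (λ x → ++-assoc v x w) q ⟩
    sandwich v w q
      ∎
    where open ≡-Reasoning

  sandwich-[]-[] : (q : F A) → sandwich [] [] q ≡ q
  sandwich-[]-[] q = ≡-trans (map-cong ++-identityʳ q) (map-id q)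

  ⊙-distribʳ-⊕ : (p p′ q : F A) → (p ⊕ p′) ⊙ q ≡ p ⊙ q ⊕ p′ ⊙ q
  ⊙-distribʳ-⊕ p p′ q = concatMap-++ (λ u → map (u ++_) q) p p′

  ⊙⁺ʳ : ∀ {p p′} (q : F A) → p ↭ p′ → p ⊙ q ↭ p′ ⊙ q
  ⊙⁺ʳ q refl            = refl
  ⊙⁺ʳ q (prep x p↭p′)   = ++⁺ˡ (map (x ++_) q) (⊙⁺ʳ q p↭p′)
  ⊙⁺ʳ q (swap x y p↭p′) =
    ↭-trans (++⁺ˡ (map (x ++_) q) (++⁺ˡ (map (y ++_) q) (⊙⁺ʳ q p↭p′)))
            (shifts (map (x ++_) q) (map (y ++_) q))
  ⊙⁺ʳ q (trans p↭p″ p″↭p′) = ↭-trans (⊙⁺ʳ q p↭p″) (⊙⁺ʳ q p″↭p′)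

  ⊙⁺ˡ : ∀ (p : F A) {q q′} → q ↭ q′ → p ⊙ q ↭ p ⊙ q′
  ⊙⁺ˡ []      q↭q′ = refl
  ⊙⁺ˡ (u ∷ p) q↭q′ = ++⁺ (map⁺ (u ++_) q↭q′) (⊙⁺ˡ p q↭q′)

module Expansions {A : Set} {I : Set} (e : I → F A) where

  infix 4 _⇒₁_ _⇒_ _⇛_ _⇛*_

  data _⇒₁_ (u : Word A) : F A → Set where
    keep   : u ⇒₁ mono u
    expand : ∀ v w i → u ≡ v ++ w → u ⇒₁ sandwich v w (e i)

  data _⇒_ : F A → F A → Set where
    []  : [] ⇒ []
    _∷_ : ∀ {u a p q} → u ⇒₁ a → p ⇒ q → u ∷ p ⇒ a ⊕ q

  -- Elements of F are lists up to _↭_, so a step may reorder summands before and after.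
  _⇛_ : F A → F A → Set
  p ⇛ r = ∃₂ λ p′ r′ → p ↭ p′ × p′ ⇒ r′ × r′ ↭ r

  _⇛*_ : F A → F A → Set
  _⇛*_ = Star _⇛_

  ⇒-refl : (p : F A) → p ⇒ p
  ⇒-refl []      = []
  ⇒-refl (u ∷ p) = keep ∷ ⇒-refl p

  ⇒-⊕ : ∀ {p q p′ q′} → p ⇒ q → p′ ⇒ q′ → p ⊕ p′ ⇒ q ⊕ q′
  ⇒-⊕ [] p′⇒q′ = p′⇒q′
  ⇒-⊕ {q′ = q′} (_∷_ {a = a} {q = q} s p⇒q) p′⇒q′ =
    subst (_ ⇒_) (sym (++-assoc a q q′)) (s ∷ ⇒-⊕ p⇒q p′⇒q′)

  ⇒-concatMap : {B : Set} {f : B → Word A} {g : B → F A} →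
    (∀ x → f x ⇒₁ g x) → (xs : List B) → map f xs ⇒ concatMap g xs
  ⇒-concatMap s []       = []
  ⇒-concatMap s (x ∷ xs) = s x ∷ ⇒-concatMap s xs

  Joinable : F A → F A → Set
  Joinable q₁ q₂ = ∃₂ λ s₁ s₂ → q₁ ⇒ s₁ × q₂ ⇒ s₂ × s₁ ↭ s₂

  Joinable-sym : ∀ {q₁ q₂} → Joinable q₁ q₂ → Joinable q₂ q₁
  Joinable-sym (s₁ , s₂ , q₁⇒s₁ , q₂⇒s₂ , s₁↭s₂) = s₂ , s₁ , q₂⇒s₂ , q₁⇒s₁ , ↭-sym s₁↭s₂

  overlap-joinable : ∀ v t w i j →
    Joinable (sandwich v (t ++ w) (e i)) (sandwich (v ++ t) w (e j))
  overlap-joinable v t w i j =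
    concatMap (λ x → sandwich (v ++ x ++ t) w (e j)) (e i) ,
    concatMap (λ y → sandwich v (t ++ y ++ w) (e i)) (e j) ,
    ⇒-concatMap (λ x → expand (v ++ x ++ t) w j (sym (++-assoc₄ v x t w))) (e i) ,
    ⇒-concatMap (λ y → expand v (t ++ y ++ w) i (++-assoc v t (y ++ w))) (e j) ,
    ↭-trans (↭-reflexive (concatMap-cong (λ x → map-cong (λ y → ++-assoc₄ v x t (y ++ w)) (e j)) (e i)))
            (concatMap-map-comm (λ x y → v ++ x ++ t ++ y ++ w) (e i) (e j))

  ⇒₁-diamond : ∀ {u a₁ a₂} → u ⇒₁ a₁ → u ⇒₁ a₂ → Joinable a₁ a₂
  ⇒₁-diamond keep keep = -, -, ⇒-refl _ , ⇒-refl _ , ↭-refl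
  ⇒₁-diamond keep (expand v w i u≡vw) =
    -, -, expand v w i u≡vw ∷ [] , ⇒-refl _ , ↭-reflexive (++-identityʳ _)
  ⇒₁-diamond (expand v w i u≡vw) keep =
    -, -, ⇒-refl _ , expand v w i u≡vw ∷ [] , ↭-reflexive (sym (++-identityʳ _))
  ⇒₁-diamond (expand v w i u≡vw) (expand v′ w′ j u≡v′w′)
    with ++-split v w v′ w′ (≡-trans (sym u≡vw) u≡v′w′)
  ... | inj₁ (t , refl , refl) = overlap-joinable v t w′ i j
  ... | inj₂ (t , refl , refl) = Joinable-sym (overlap-joinable v′ t w j i)

  ⇒-diamond : ∀ {p q₁ q₂} → p ⇒ q₁ → p ⇒ q₂ → Joinable q₁ q₂
  ⇒-diamond [] [] = -, -, [] , [] , ↭-refl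
  ⇒-diamond (s₁ ∷ p⇒q₁) (s₂ ∷ p⇒q₂) with ⇒₁-diamond s₁ s₂ | ⇒-diamond p⇒q₁ p⇒q₂
  ... | _ , _ , x₁ , x₂ , x₁↭x₂ | _ , _ , y₁ , y₂ , y₁↭y₂ =
    -, -, ⇒-⊕ x₁ y₁ , ⇒-⊕ x₂ y₂ , ++⁺ x₁↭x₂ y₁↭y₂

  ⇒-along-↭ : ∀ {p p′ r} → p ↭ p′ → p ⇒ r → ∃ λ r′ → p′ ⇒ r′ × r ↭ r′
  ⇒-along-↭ refl p⇒r = -, p⇒r , ↭-refl
  ⇒-along-↭ (prep x p↭p′) (_∷_ {a = a} s p⇒r) with ⇒-along-↭ p↭p′ p⇒r
  ... | _ , p′⇒r′ , r↭r′ = -, s ∷ p′⇒r′ , ++⁺ˡ a r↭r′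
  ⇒-along-↭ (swap x y p↭p′) (_∷_ {a = a} s (_∷_ {a = b} s′ p⇒r)) with ⇒-along-↭ p↭p′ p⇒r
  ... | r′ , p′⇒r′ , r↭r′ = -, s′ ∷ s ∷ p′⇒r′ , ↭-trans (++⁺ˡ a (++⁺ˡ b r↭r′)) (shifts a b)
  ⇒-along-↭ (trans p↭p″ p″↭p′) p⇒r with ⇒-along-↭ p↭p″ p⇒r
  ... | _ , p″⇒r″ , r↭r″ with ⇒-along-↭ p″↭p′ p″⇒r″
  ...   | _ , p′⇒r′ , r″↭r′ = -, p′⇒r′ , ↭-trans r↭r″ r″↭r′

  ⇛-diamond : Diamond _⇛_
  ⇛-diamond (_ , _ , p↭p₁ , p₁⇒r₁ , r₁↭q₁) (_ , _ , p↭p₂ , p₂⇒r₂ , r₂↭q₂)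
    with ⇒-along-↭ (↭-trans (↭-sym p↭p₁) p↭p₂) p₁⇒r₁
  ... | r₁′ , p₂⇒r₁′ , r₁↭r₁′ with ⇒-diamond p₂⇒r₁′ p₂⇒r₂
  ...   | s₁ , s₂ , r₁′⇒s₁ , r₂⇒s₂ , s₁↭s₂ =
    s₂ , (-, -, ↭-trans (↭-sym r₁↭q₁) r₁↭r₁′ , r₁′⇒s₁ , s₁↭s₂)
       , (-, -, ↭-sym r₂↭q₂ , r₂⇒s₂ , ↭-refl)

  ⇛*-confluent : Confluent _⇛_
  ⇛*-confluent = diamond⇒confluent ⇛-diamond

  ↭⇒⇛ : ∀ {p q} → p ↭ q → p ⇛ q
  ↭⇒⇛ {p} p↭q = p , p , ↭-refl , ⇒-refl p , p↭q

  ⇛-⊕ : ∀ {p r p′ r′} → p ⇛ r → p′ ⇛ r′ → p ⊕ p′ ⇛ r ⊕ r′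
  ⇛-⊕ (_ , _ , p↭ , p⇒ , ⇒↭r) (_ , _ , p′↭ , p′⇒ , ⇒↭r′) =
    -, -, ++⁺ p↭ p′↭ , ⇒-⊕ p⇒ p′⇒ , ++⁺ ⇒↭r ⇒↭r′

  ⇛-respˡ-↭ : ∀ {p p′ r} → p ↭ p′ → p′ ⇛ r → p ⇛ r
  ⇛-respˡ-↭ p↭p′ (_ , _ , p′↭ , ⇒r , ↭r) = -, -, ↭-trans p↭p′ p′↭ , ⇒r , ↭r

  ⇛-respʳ-↭ : ∀ {p r r′} → r ↭ r′ → p ⇛ r → p ⇛ r′
  ⇛-respʳ-↭ r↭r′ (_ , _ , p↭ , ⇒r , ↭r) = -, -, p↭ , ⇒r , ↭-trans ↭r r↭r′

  ⇒-prefix : ∀ u {p r} → p ⇒ r → map (u ++_) p ⇒ map (u ++_) r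
  ⇒-prefix u [] = []
  ⇒-prefix u (keep ∷ p⇒r) = keep ∷ ⇒-prefix u p⇒r
  ⇒-prefix u (_∷_ {q = r} (expand v w i x≡vw) p⇒r) =
    subst (_ ⇒_) (sym prefix-expansion)
      (expand (u ++ v) w i (≡-trans (cong (u ++_) x≡vw) (sym (++-assoc u v w))) ∷ ⇒-prefix u p⇒r)
    where
    open ≡-Reasoning
    prefix-expansion : map (u ++_) (sandwich v w (e i) ⊕ r) ≡ sandwich (u ++ v) w (e i) ⊕ map (u ++_) r
    prefix-expansion = begin
      map (u ++_) (sandwich v w (e i) ++ r)             ≡⟨ map-++ (u ++_) (sandwich v w (e i)) r ⟩
      map (u ++_) (sandwich v w (e i)) ++ map (u ++_) r ≡⟨ cong (_++ map (u ++_) r) (map-∘ (e i)) ⟨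
      map (λ x → u ++ v ++ x ++ w) (e i) ++ map (u ++_) r
        ≡⟨ cong (_++ map (u ++_) r) (map-cong (λ x → sym (++-assoc u v (x ++ w))) (e i)) ⟩
      sandwich (u ++ v) w (e i) ++ map (u ++_) r        ∎

  ⇒-⊙ˡ : ∀ (p : F A) {q r} → q ⇒ r → p ⊙ q ⇒ p ⊙ r
  ⇒-⊙ˡ []      q⇒r = []
  ⇒-⊙ˡ (u ∷ p) q⇒r = ⇒-⊕ (⇒-prefix u q⇒r) (⇒-⊙ˡ p q⇒r)

  ⇒₁-⊙ʳ : ∀ {u a} (q : F A) → u ⇒₁ a → map (u ++_) q ⇛ a ⊙ q
  ⇒₁-⊙ʳ q keep = ↭⇒⇛ (↭-reflexive (sym (++-identityʳ _)))
  ⇒₁-⊙ʳ q (expand v w i u≡vw) =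
    -, -, ↭-refl ,
    ⇒-concatMap (λ y → expand v (w ++ y) i (≡-trans (cong (_++ y) u≡vw) (++-assoc v w y))) q ,
    ↭-trans (↭-sym (concatMap-map-comm (λ x y → v ++ x ++ w ++ y) (e i) q))
            (↭-reflexive (≡-trans (concatMap-cong (λ x → map-cong (λ y → sym (++-assoc₄ v x w y)) q) (e i))
                                  (sym (concatMap-map (λ x → map (x ++_) q) (λ x → v ++ x ++ w) (e i)))))

  ⇒-⊙ʳ : ∀ (q : F A) {p r} → p ⇒ r → p ⊙ q ⇛ r ⊙ q
  ⇒-⊙ʳ q [] = ↭⇒⇛ ↭-refl
  ⇒-⊙ʳ q (_∷_ {a = a} {q = r} s p⇒r) =
    ⇛-respʳ-↭ (↭-reflexive (sym (⊙-distribʳ-⊕ a r q))) (⇛-⊕ (⇒₁-⊙ʳ q s) (⇒-⊙ʳ q p⇒r))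

  ⇛-⊙ˡ : ∀ (p : F A) {q r} → q ⇛ r → p ⊙ q ⇛ p ⊙ r
  ⇛-⊙ˡ p (_ , _ , q↭ , ⇒r , ↭r) = -, -, ⊙⁺ˡ p q↭ , ⇒-⊙ˡ p ⇒r , ⊙⁺ˡ p ↭r

  ⇛-⊙ʳ : ∀ (q : F A) {p r} → p ⇛ r → p ⊙ q ⇛ r ⊙ q
  ⇛-⊙ʳ q (_ , _ , p↭ , ⇒r , ↭r) = ⇛-respˡ-↭ (⊙⁺ʳ q p↭) (⇛-respʳ-↭ (⊙⁺ʳ q ↭r) (⇒-⊙ʳ q ⇒r))

  ⇛*-⊕ : ∀ {p q r s} → p ⇛* r → q ⇛* s → p ⊕ q ⇛* r ⊕ s
  ⇛*-⊕ {q = q} {r = r} p⇛*r q⇛*s =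
    gmap (_⊕ q) (λ p⇛r → ⇛-⊕ p⇛r (↭⇒⇛ ↭-refl)) p⇛*r ◅◅ gmap (r ⊕_) (⇛-⊕ (↭⇒⇛ ↭-refl)) q⇛*s

  ⇛*-⊙ : ∀ {p q r s} → p ⇛* r → q ⇛* s → p ⊙ q ⇛* r ⊙ s
  ⇛*-⊙ {q = q} {r = r} p⇛*r q⇛*s = gmap (_⊙ q) (⇛-⊙ʳ q) p⇛*r ◅◅ gmap (r ⊙_) (⇛-⊙ˡ r) q⇛*s

  Expansion-respˡ-↭ : ∀ {p p′ r} → p ↭ p′ → Expansion e p′ r → Expansion e p r
  Expansion-respˡ-↭ p↭p′ (done p′↭r) = done (↭-trans p↭p′ p′↭r)
  Expansion-respˡ-↭ p↭p′ (step (xs , ys , v , w , i , p′↭ , q↭) q→r) =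
    step (xs , ys , v , w , i , ↭-trans p↭p′ p′↭ , q↭) q→r

  Expansion-trans : ∀ {p q r} → Expansion e p q → Expansion e q r → Expansion e p r
  Expansion-trans (done p↭q)    q→r = Expansion-respˡ-↭ p↭q q→r
  Expansion-trans (step s p′→q) q→r = step s (Expansion-trans p′→q q→r)

  Expansion-⊕ˡ : ∀ s {p r} → Expansion e p r → Expansion e (s ⊕ p) (s ⊕ r)
  Expansion-⊕ˡ s (done p↭r) = done (++⁺ˡ s p↭r)
  Expansion-⊕ˡ s (step (xs , ys , v , w , i , p↭ , q↭) q→r) =
    step (s ⊕ xs , ys , v , w , i , reassoc p↭ , reassoc q↭) (Expansion-⊕ˡ s q→r)
    where
    reassoc : ∀ {p m} → p ↭ xs ⊕ (m ⊕ ys) → s ⊕ p ↭ s ⊕ xs ⊕ (m ⊕ ys)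
    reassoc {m = m} p↭ = ↭-trans (++⁺ˡ s p↭) (↭-reflexive (sym (++-assoc s xs (m ⊕ ys))))

  ⇒⇒Expansion : ∀ {p r} → p ⇒ r → Expansion e p r
  ⇒⇒Expansion [] = done ↭-refl
  ⇒⇒Expansion (_∷_ {u = u} keep p⇒r) = Expansion-⊕ˡ (mono u) (⇒⇒Expansion p⇒r)
  ⇒⇒Expansion (_∷_ {p = p} (expand v w i u≡vw) p⇒r) =
    step ([] , p , v , w , i , ↭-reflexive (cong (_∷ p) u≡vw) ,
          ↭-reflexive (cong (_⊕ p) (sym (mono-⊙-mono v w (e i)))))
         (Expansion-⊕ˡ (sandwich v w (e i)) (⇒⇒Expansion p⇒r))

  ⇛*⇒Expansion : ∀ {p r} → p ⇛* r → Expansion e p r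
  ⇛*⇒Expansion ε = done ↭-refl
  ⇛*⇒Expansion ((_ , _ , p↭ , p′⇒r′ , r′↭) ◅ q⇛*r) =
    Expansion-respˡ-↭ p↭ (Expansion-trans (⇒⇒Expansion p′⇒r′) (Expansion-respˡ-↭ r′↭ (⇛*⇒Expansion q⇛*r)))

  SingleExpansion⇒⇛ : ∀ {p q} → SingleExpansion e p q → p ⇛ q
  SingleExpansion⇒⇛ (xs , ys , v , w , i , p↭ , q↭) =
    -, -, p↭ , ⇒-⊕ (⇒-refl xs) (expand v w i refl ∷ ⇒-refl ys) ,
    ↭-trans (↭-reflexive (cong (λ m → xs ⊕ (m ⊕ ys)) (sym (mono-⊙-mono v w (e i))))) (↭-sym q↭)

  Expansion⇒⇛* : ∀ {p r} → Expansion e p r → p ⇛* r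
  Expansion⇒⇛* (done p↭r)   = ↭⇒⇛ p↭r ◅ ε
  Expansion⇒⇛* (step s q→r) = SingleExpansion⇒⇛ s ◅ Expansion⇒⇛* q→r

  Expansion⇒Cong : ∀ {p r} → Expansion e p r → Cong e p r
  Expansion⇒Cong (done p↭r) = c-eq p↭r
  Expansion⇒Cong (step (xs , ys , v , w , i , p↭ , q↭) q→r) =
    c-trans (c-eq p↭)
   (c-trans (c-+ (c-eq ↭-refl) (c-+ monomial-expansion (c-eq ↭-refl)))
   (c-trans (c-eq (↭-sym q↭))
            (Expansion⇒Cong q→r)))
    where
    monomial-expansion : Cong e (mono (v ++ w)) (mono v ⊙ e i ⊙ mono w)
    monomial-expansion =
      c-trans (c-eq (↭-reflexive (sym (mono-⊙-mono v w 1F))))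
              (c-· (c-· (c-eq {p = mono v} ↭-refl) (c-sym (c-gen i))) (c-eq {p = mono w} ↭-refl))

  CommonReduct : F A → F A → Set
  CommonReduct p q = ∃ λ r → p ⇛* r × q ⇛* r

  Cong⇒CommonReduct : ∀ {p q} → Cong e p q → CommonReduct p q
  Cong⇒CommonReduct (c-eq p↭q) = -, ↭⇒⇛ p↭q ◅ ε , ε
  Cong⇒CommonReduct (c-gen i)  = e i , ε , one-expands ◅ ε
    where
    one-expands : 1F ⇛ e i
    one-expands = -, -, ↭-refl , expand [] [] i refl ∷ [] ,
                  ↭-reflexive (≡-trans (++-identityʳ _) (sandwich-[]-[] (e i)))
  Cong⇒CommonReduct (c-sym p≅q) with Cong⇒CommonReduct p≅q
  ... | r , p⇛*r , q⇛*r = r , q⇛*r , p⇛*r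
  Cong⇒CommonReduct (c-trans p≅q q≅s) with Cong⇒CommonReduct p≅q | Cong⇒CommonReduct q≅s
  ... | _ , p⇛*r , q⇛*r | _ , q⇛*r′ , s⇛*r′ with ⇛*-confluent q⇛*r q⇛*r′
  ...   | _ , r⇛*d , r′⇛*d = -, p⇛*r ◅◅ r⇛*d , s⇛*r′ ◅◅ r′⇛*d
  Cong⇒CommonReduct (c-+ p≅p′ q≅q′) with Cong⇒CommonReduct p≅p′ | Cong⇒CommonReduct q≅q′
  ... | _ , p⇛* , p′⇛* | _ , q⇛* , q′⇛* = -, ⇛*-⊕ p⇛* q⇛* , ⇛*-⊕ p′⇛* q′⇛*
  Cong⇒CommonReduct (c-· p≅p′ q≅q′) with Cong⇒CommonReduct p≅p′ | Cong⇒CommonReduct q≅q′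
  ... | _ , p⇛* , p′⇛* | _ , q⇛* , q′⇛* = -, ⇛*-⊙ p⇛* q⇛* , ⇛*-⊙ p′⇛* q′⇛*

mainTheorem3 : (A : Set) (I : Set) (e : I → F A) (p q : F A) →
    Cong e p q ⇔ Σ (F A) (λ r → Expansion e p r × Expansion e q r)
mainTheorem3 A I e p q = mk⇔ common-expansion (λ (_ , p→r , q→r) → congruent p→r q→r)
  where
  open Expansions e

  common-expansion : Cong e p q → Σ (F A) (λ r → Expansion e p r × Expansion e q r)
  common-expansion p≅q with Cong⇒CommonReduct p≅q
  ... | r , p⇛*r , q⇛*r = r , ⇛*⇒Expansion p⇛*r , ⇛*⇒Expansion q⇛*r

  congruent : ∀ {r} → Expansion e p r → Expansion e q r → Cong e p q
  congruent p→r q→r = c-trans (Expansion⇒Cong p→r) (c-sym (Expansion⇒Cong q→r))
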